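{- The Tree Algorithm, for every choice of balanced separator vertices it makes, returns a hub labeling of the input tree $T$ whose $\ell_1$-cost is at most $2\cdot \mathrm{OPT}$, where $\mathrm{OPT}$ is the minimum $\ell_1$-cost of a hub labeling of $T$. That is, the Tree Algorithm is a 2-approximation algorithm for HL$_1$ on trees.
   Context: Let $T=(V,E)$ be a finite (unweighted) tree. For $u,v\in V$, $P_{uv}$ denotes the set of vertices of the unique $u$–$v$ path in $T$, including $u$ and $v$. A hub labeling of $T$ is a family $H=(H_u)_{u\in V}$ of sets $H_u\subseteq V$ such that $H_u\cap H_v\cap P_{uv}\neq\emptyset$ for all $u,v\in V$ (including $u=v$). Its $\ell_1$-cost is $\sum_{u\in V}|H_u|$; HL$_1$ is the problem of finding a hub labeling of minimum $\ell_1$-cost. A vertex $r$ of a tree $T'$ on $n'$ vertices is a balanced separator vertex if every connected component of $T'-r$ has at most $n'/2$ vertices. The Tree Algorithm on a tree $T'$: (1) find a balanced separator vertex $r$ of $T'$; (2) recursively apply the algorithm to each connected component of $T'-r$ (no recursive call if $T'$ is a single vertex), obtaining labelings $H'$; (3) return $H_u:=H'_u\cup\{r\}$ for every $u\in T'\setminus\{r\}$ and $H_r=\{r\}$. -}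

module Defs where

open import Data.Nat using (ℕ; _≤_; _*_; _+_)
open import Data.Fin using (Fin)
open import Data.Fin.Subset using (Subset; _∈_; _∉_; _⊆_; _∪_; ⁅_⁆; ∣_∣; Nonempty)
open import Data.List using (List; []; _∷_; length; map; allFin)
open import Data.Nat.ListAction using (sum)
open import Data.List.Relation.Unary.All using (All)
open import Data.List.Relation.Unary.Unique.Propositional using (Unique)
import Data.List.Membership.Propositional as LM
open import Data.Product using (Σ; ∃; ∃-syntax; _×_)
open import Relation.Nullary using (¬_)
open import Relation.Binary.PropositionalEquality using (_≡_; _≢_)
open import Level using (0ℓ)

record Graph (n : ℕ) : Set₁ where
  field
    Adj     : Fin n → Fin n → Set
    sym     : ∀ {u v} → Adj u v → Adj v u
    irrefl  : ∀ {u} → ¬ Adj u u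

module _ {n : ℕ} (G : Graph n) where
  open Graph G

  data Walk : Fin n → Fin n → Set where
    here : ∀ {u} → Walk u u
    step : ∀ {u v w} → Adj u v → Walk v w → Walk u w

  verts : ∀ {u v} → Walk u v → List (Fin n)
  verts {u} here       = u ∷ []
  verts {u} (step _ p) = u ∷ verts p

  IsPath : ∀ {u v} → Walk u v → Set
  IsPath p = Unique (verts p)

  Connected : Set
  Connected = ∀ u v → Walk u v

  HasCycle : Set
  HasCycle = ∃[ u ] ∃[ v ] Σ (Walk u v) λ p →
               IsPath p × 3 ≤ length (verts p) × Adj v u

  IsTree : Set
  IsTree = Connected × ¬ HasCycle

  -- w ∈ P_uv : w lies on a (in a tree: the unique) u–v path
  OnPath : Fin n → Fin n → Fin n → Set
  OnPath w u v = Σ (Walk u v) λ p → IsPath p × w LM.∈ verts p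

  IsHubLabeling : (Fin n → Subset n) → Set
  IsHubLabeling H = ∀ u v → ∃[ w ] (w ∈ H u × w ∈ H v × OnPath w u v)

  cost : (Fin n → Subset n) → ℕ
  cost H = sum (map (λ u → ∣ H u ∣) (allFin n))

  ConnectedIn : Subset n → Set
  ConnectedIn C = ∀ u v → u ∈ C → v ∈ C →
                  Σ (Walk u v) λ p → All (λ x → x ∈ C) (verts p)

  -- C is (the vertex set of) a connected component of G[S] - r
  IsComponent : Subset n → Fin n → Subset n → Set
  IsComponent S r C =
      C ⊆ S × r ∉ C × Nonempty C × ConnectedIn C ×
      (∀ x y → x ∈ C → y ∈ S → y ≢ r → Adj x y → y ∈ C)

  BalancedSeparator : Subset n → Fin n → Set
  BalancedSeparator S r =
    r ∈ S × (∀ C → IsComponent S r C → 2 * ∣ C ∣ ≤ ∣ S ∣)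

  -- TreeAlg S H : H is a possible output (for some choice of balanced
  -- separators) of the Tree Algorithm run on G[S]; only the labels H u
  -- with u ∈ S are the output, values outside S are irrelevant.
  -- The recursive outputs of all components are collected in one
  -- function H' (the components are disjoint).
  data TreeAlg : Subset n → (Fin n → Subset n) → Set where
    run : ∀ {S H} (r : Fin n) → BalancedSeparator S r →
          (H' : Fin n → Subset n) →
          (∀ C → IsComponent S r C → TreeAlg C H') →
          H r ≡ ⁅ r ⁆ →
          (∀ u → u ∈ S → u ≢ r → H u ≡ H' u ∪ ⁅ r ⁆) →
          TreeAlg S H

-- Correctness: if the u–v path passes through the separator r, then r, a hub
-- of every vertex, covers u and v; otherwise u and v lie in one component of
-- T[S] - r and are covered by the recursive labeling.
--
-- Cost: fix a hub labeling H* and let B(S) = Σ_{u ∈ S} |H*_u ∩ S|, so that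
-- B(V) ≤ cost H*.  By induction along the run, an output on S costs at most
-- 2 B(S): it costs at most |S| plus the recursive costs, at most 2 B(C) for
-- each component C, and |S| is at most twice the number of hubs H*_u ∩ S that
-- are not in the component of u (counting H*_r ∩ S, which contains r).
-- Indeed the vertices with no such hub pairwise share a hub inside S, hence a
-- component, which the balanced separator makes at most half of S.
module Submission where

open import Defs
open import Level using (0ℓ)
open import Function using (_∘_)
open import Data.Nat using (ℕ; zero; suc; _≤_; _<_; _*_; _+_; s≤s; z≤n)
open import Data.Nat.Properties
  using (≤-trans; ≤-reflexive; +-mono-≤; +-monoˡ-≤; +-monoʳ-≤; *-monoʳ-≤; +-assoc; +-comm;
         +-suc; +-identityʳ; *-zeroʳ; *-distribˡ-+; m≤n+m; n≢0⇒n>0; +-cancelˡ-≤; module ≤-Reasoning)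
open import Data.Nat.Properties using (+-commutativeSemigroup) renaming (_≟_ to _≟ℕ_)
open import Algebra.Properties.CommutativeSemigroup +-commutativeSemigroup using (x∙yz≈y∙xz; interchange)
open import Data.Nat.ListAction using (sum)
open import Data.Nat.Induction using (<-wellFounded)
open import Data.Nat.Tactic.RingSolver using (solve-∀)
open import Data.Fin using (Fin; _≟_) renaming (zero to fzero; suc to fsuc)
open import Data.Fin.Properties using (any?)
open import Data.Vec using ([]; _∷_; here; there) renaming (tabulate to tabulateᵛ)
open import Data.Vec.Properties using (lookup∘tabulate; []=⇒lookup; lookup⇒[]=)
open import Data.Fin.Subset using (Subset; inside; outside; _∈_; _∉_; _⊆_; _∩_; _∪_; ∁; ⁅_⁆; ∣_∣; ⊤)
import Data.Fin.Subset as Subset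
open import Data.Fin.Subset.Properties
  using (_∈?_; ⊆-antisym; ∩-assoc; p∩q⊆q; x∈⁅x⁆; x≢y⇒x∉⁅y⁆; x∈p∪q⁺; x∈p∩q⁺; x∈p∩q⁻;
         x∈∁p⇒x∉p; x∉p⇒x∈∁p; ∈⊤; nonempty?; ∣⁅x⁆∣≡1; ∣⊥∣≡0; ∣p∩q∣≤∣p∣; ∣p∩q∣≤∣q∣; ∣p∣≤∣x∷p∣)
open import Induction.WellFounded using (Acc; acc)
open import Data.List using (List; []; _∷_; length; _++_; map; allFin; tabulate)
open import Data.List.Properties using (length-++; map-tabulate)
open import Data.List.Relation.Unary.All as All using (All; []; _∷_; all?)
open import Data.List.Relation.Unary.All.Properties using (¬Any⇒All¬)
open import Data.List.Relation.Unary.Any using (here; there)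
open import Data.List.Relation.Unary.Unique.Propositional using (Unique) renaming (tail to unique-tail)
open import Data.List.Relation.Unary.Unique.Propositional.Properties using (++⁺; Unique[x∷xs]⇒x∉xs)
open import Data.List.Relation.Unary.AllPairs using ([]; _∷_)
import Data.List.Membership.Propositional as L
open import Data.List.Membership.Propositional.Properties using (∈-++⁻)
open import Data.List.Membership.DecPropositional using () renaming (_∈?_ to _∈ᴸ?_)
open import Data.List.Relation.Binary.Subset.Propositional using () renaming (_⊆_ to _⊆ᴸ_)
open import Data.Product using (Σ; ∃-syntax; _×_; _,_; proj₁; proj₂)
open import Data.Sum using (_⊎_; inj₁; inj₂; [_,_]′)
open import Data.Empty using (⊥; ⊥-elim)
open import Relation.Nullary using (¬_; Dec; yes; no; does)
open import Relation.Nullary.Decidable using (_×-dec_)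
open import Relation.Unary using (Pred; Decidable)
open import Relation.Binary.PropositionalEquality
  using (_≡_; _≢_; refl; sym; trans; cong; cong₂; subst)

module Walks {n : ℕ} (G : Graph n) where
  open Graph G renaming (sym to adj-sym)

  later : ∀ {u v} → Walk G u v → List (Fin n)
  later here       = []
  later (step _ p) = verts G p

  verts-later : ∀ {u v} (p : Walk G u v) → verts G p ≡ u ∷ later p
  verts-later here       = refl
  verts-later (step _ p) = refl

  first∈ : ∀ {u v} (p : Walk G u v) → u L.∈ verts G p
  first∈ p rewrite verts-later p = here refl

  later⊆verts : ∀ {u v} (p : Walk G u v) → later p ⊆ᴸ verts G p
  later⊆verts p m = subst (_ L.∈_) (sym (verts-later p)) (there m)

  last∈ : ∀ {u v} (p : Walk G u v) → v L.∈ verts G p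
  last∈ here       = here refl
  last∈ (step _ p) = there (last∈ p)

  later-nonempty : ∀ {u v} → u ≢ v → (p : Walk G u v) → 1 ≤ length (later p)
  later-nonempty u≢u here      = ⊥-elim (u≢u refl)
  later-nonempty _ (step _ p) rewrite verts-later p = s≤s z≤n

  infixr 5 _++ʷ_
  _++ʷ_ : ∀ {a b c} → Walk G a b → Walk G b c → Walk G a c
  here     ++ʷ q = q
  step e p ++ʷ q = step e (p ++ʷ q)

  verts-++ʷ : ∀ {a b c} (p : Walk G a b) (q : Walk G b c) →
              verts G (p ++ʷ q) ≡ verts G p ++ later q
  verts-++ʷ here       q = verts-later q
  verts-++ʷ (step e p) q = cong (_ ∷_) (verts-++ʷ p q)

  ∈-++ʷ⁻ : ∀ {a b c} (p : Walk G a b) (q : Walk G b c) {x} →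
           x L.∈ verts G (p ++ʷ q) → x L.∈ verts G p ⊎ x L.∈ verts G q
  ∈-++ʷ⁻ p q m with ∈-++⁻ (verts G p) (subst (_ L.∈_) (verts-++ʷ p q) m)
  ... | inj₁ m₁ = inj₁ m₁
  ... | inj₂ m₂ = inj₂ (subst (_ L.∈_) (sym (verts-later q)) (there m₂))

  rev : ∀ {a b} → Walk G a b → Walk G b a
  rev here       = here
  rev (step e p) = rev p ++ʷ step (adj-sym e) here

  verts-rev : ∀ {a b} (p : Walk G a b) → verts G (rev p) ⊆ᴸ verts G p
  verts-rev here m = m
  verts-rev (step e p) m with ∈-++ʷ⁻ (rev p) (step (adj-sym e) here) m
  ... | inj₁ m₁                 = there (verts-rev p m₁)
  ... | inj₂ (here refl)         = there (first∈ p)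
  ... | inj₂ (there (here refl)) = here refl

  rev-path : ∀ {a b} (p : Walk G a b) → IsPath G p → IsPath G (rev p)
  rev-path here       u = u
  rev-path (step e p) (a∉p ∷ up) =
    subst Unique (sym (verts-++ʷ (rev p) (step (adj-sym e) here)))
      (++⁺ (rev-path p up) ([] ∷ []) λ { (m , here refl) → All.lookup a∉p (verts-rev p m) refl })

  unique-∷ : ∀ {x} {xs : List (Fin n)} → ¬ x L.∈ xs → Unique xs → Unique (x ∷ xs)
  unique-∷ {xs = xs} x∉xs u = ¬Any⇒All¬ xs x∉xs ∷ u

  record Piece {a b} (p : Walk G a b) (x y : Fin n) : Set where
    field
      walk   : Walk G x y
      within : verts G walk ⊆ᴸ verts G p
      path   : IsPath G p → IsPath G walk
  open Piece

  whole : ∀ {a b} (p : Walk G a b) → Piece p a b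
  whole p = record { walk = p ; within = λ m → m ; path = λ u → u }

  start : ∀ {a b} (p : Walk G a b) → Piece p a a
  start p = record { walk = here ; within = λ { (here refl) → first∈ p } ; path = λ _ → [] ∷ [] }

  shrink : ∀ {a a₁ b x y} {e : Adj a a₁} {p : Walk G a₁ b} → Piece p x y → Piece (step e p) x y
  shrink s = record { walk = walk s ; within = there ∘ within s ; path = λ { (_ ∷ u) → path s u } }

  extend : ∀ {a a₁ b y} (e : Adj a a₁) {p : Walk G a₁ b} → Piece p a₁ y → Piece (step e p) a y
  extend e s = record
    { walk   = step e (walk s)
    ; within = λ { (here refl) → here refl ; (there m) → there (within s m) }
    ; path   = λ { (a∉p ∷ u) → unique-∷ (λ m → All.lookup a∉p (within s m) refl) (path s u) }
    }

  prefix : ∀ {a b z} (p : Walk G a b) → z L.∈ verts G p → Piece p a z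
  prefix here       (here refl) = start here
  prefix (step e p) (here refl) = start (step e p)
  prefix (step e p) (there m)   = extend e (prefix p m)

  suffix : ∀ {a b z} (p : Walk G a b) → z L.∈ verts G p → Piece p z b
  suffix here       (here refl) = whole here
  suffix (step e p) (here refl) = whole (step e p)
  suffix (step e p) (there m)   = shrink (suffix p m)

  toPath : ∀ {a b} (q : Walk G a b) → Σ (Walk G a b) λ p → IsPath G p × verts G p ⊆ᴸ verts G q
  toPath here = here , [] ∷ [] , λ m → m
  toPath {a} (step e q) with toPath q
  ... | p , up , p⊆q with _∈ᴸ?_ _≟_ a (verts G p)
  ... | yes a∈p = let s = suffix p a∈p in walk s , path s up , there ∘ p⊆q ∘ within s
  ... | no a∉p  = step e p , unique-∷ a∉p up , λ { (here refl) → here refl ; (there m) → there (p⊆q m) }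

  firstHit : ∀ {a b} {D : Pred (Fin n) 0ℓ} → Decidable D → D b → (p : Walk G a b) →
             ∃[ z ] Σ (Piece p a z) λ s → D z × (∀ {y} → y L.∈ verts G (walk s) → D y → y ≡ z)
  firstHit D? db here = _ , whole here , db , λ { (here refl) _ → refl }
  firstHit {a} D? db (step e p) with D? a
  ... | yes da = a , start (step e p) , da , λ { (here refl) _ → refl }
  ... | no ¬da with firstHit D? db p
  ... | z , s , dz , onlyZ =
    z , extend e s , dz , λ { (here refl) da → ⊥-elim (¬da da) ; (there m) dy → onlyZ m dy }

module Acyclic {n : ℕ} (G : Graph n) (acyclic : ¬ HasCycle G) where
  open Graph G renaming (sym to adj-sym)
  open Walks G
  open Piece

  -- Let a ~ a₁, let p be a path a₁ → b avoiding a and q a path a → b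
  -- avoiding a₁, and let z be the first vertex of p on q.  Following q from
  -- a to z, then p backwards from z to a₁, and the edge back to a, is a cycle.
  detour-cycle : ∀ {a a₁ b} → Adj a a₁ →
                 (p : Walk G a₁ b) → IsPath G p → ¬ a L.∈ verts G p →
                 (q : Walk G a b) → IsPath G q → ¬ a₁ L.∈ verts G q → HasCycle G
  detour-cycle {a} {a₁} e p up a∉p q uq a₁∉q
    with firstHit (λ y → _∈ᴸ?_ _≟_ y (verts G q)) (last∈ q) p
  ... | z , s , z∈q , onlyZ = a , a₁ , c , c-path , c-length , adj-sym e
    where
    t = prefix q z∈q
    back = rev (walk s)
    c = walk t ++ʷ back

    back-unique : Unique (z ∷ later back)
    back-unique = subst Unique (verts-later back) (rev-path (walk s) (path s up))

    c-path : IsPath G c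
    c-path = subst Unique (sym (verts-++ʷ (walk t) back))
      (++⁺ (path t uq) (unique-tail back-unique) disjoint)
      where
      disjoint : ∀ {y} → y L.∈ verts G (walk t) × y L.∈ later back → ⊥
      disjoint (y∈t , y∈back) with onlyZ (verts-rev (walk s) (later⊆verts back y∈back)) (within t y∈t)
      ... | refl = Unique[x∷xs]⇒x∉xs back-unique y∈back

    a≢z : a ≢ z
    a≢z refl = a∉p (within s (last∈ (walk s)))

    c-length : 3 ≤ length (verts G c)
    c-length rewrite verts-++ʷ (walk t) back | length-++ (verts G (walk t)) {later back}
                   | verts-later (walk t) =
      s≤s (+-mono-≤ (later-nonempty a≢z (walk t))
                    (later-nonempty (λ { refl → a₁∉q z∈q }) back))

  path⊆walk : ∀ {a b} (p : Walk G a b) → IsPath G p → (q : Walk G a b) → verts G p ⊆ᴸ verts G q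
  path⊆walk here _ q (here refl) = first∈ q
  path⊆walk (step {v = a₁} e p) (a∉p ∷ up) q with _∈ᴸ?_ _≟_ a₁ (verts G q)
  ... | yes a₁∈q = λ { (here refl) → first∈ q
                     ; (there m) → within (suffix q a₁∈q) (path⊆walk p up (walk (suffix q a₁∈q)) m) }
  ... | no a₁∉q with toPath q
  ... | q′ , uq′ , q′⊆q =
    ⊥-elim (acyclic (detour-cycle e p up (λ m → All.lookup a∉p m refl) q′ uq′ (a₁∉q ∘ q′⊆q)))

module Subsets where

  -- p with the element x removed (written with ∁, which computes pointwise)
  _∖_ : ∀ {n} → Subset n → Fin n → Subset n
  p ∖ x = p ∩ ∁ ⁅ x ⁆

  ∈∖⁺ : ∀ {n} {p : Subset n} {x y} → y ∈ p → y ≢ x → y ∈ p ∖ x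
  ∈∖⁺ y∈p y≢x = x∈p∩q⁺ (y∈p , x∉p⇒x∈∁p (x≢y⇒x∉⁅y⁆ y≢x))

  ∈∖⁻ : ∀ {n} {p : Subset n} {x y} → y ∈ p ∖ x → y ∈ p × y ≢ x
  ∈∖⁻ {p = p} {x} y∈p∖x with x∈p∩q⁻ p (∁ ⁅ x ⁆) y∈p∖x
  ... | y∈p , y∈∁x = y∈p , λ { refl → x∈∁p⇒x∉p y∈∁x (x∈⁅x⁆ x) }

  ∑⟨_⟩_ : ∀ {n} → Subset n → (Fin n → ℕ) → ℕ
  ∑⟨ []          ⟩ f = 0
  ∑⟨ inside  ∷ p ⟩ f = f fzero + ∑⟨ p ⟩ (f ∘ fsuc)
  ∑⟨ outside ∷ p ⟩ f = ∑⟨ p ⟩ (f ∘ fsuc)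

  ∑-cong : ∀ {n} (p : Subset n) {f g : Fin n → ℕ} → (∀ {i} → i ∈ p → f i ≡ g i) → ∑⟨ p ⟩ f ≡ ∑⟨ p ⟩ g
  ∑-cong []            f≡g = refl
  ∑-cong (inside ∷ p)  f≡g = cong₂ _+_ (f≡g here) (∑-cong p (f≡g ∘ there))
  ∑-cong (outside ∷ p) f≡g = ∑-cong p (f≡g ∘ there)

  ∑-mono : ∀ {n} (p : Subset n) {f g : Fin n → ℕ} → (∀ {i} → i ∈ p → f i ≤ g i) → ∑⟨ p ⟩ f ≤ ∑⟨ p ⟩ g
  ∑-mono []            f≤g = z≤n
  ∑-mono (inside ∷ p)  f≤g = +-mono-≤ (f≤g here) (∑-mono p (f≤g ∘ there))
  ∑-mono (outside ∷ p) f≤g = ∑-mono p (f≤g ∘ there)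

  ∑-+ : ∀ {n} (p : Subset n) (f g : Fin n → ℕ) → ∑⟨ p ⟩ (λ i → f i + g i) ≡ ∑⟨ p ⟩ f + ∑⟨ p ⟩ g
  ∑-+ []            f g = refl
  ∑-+ (inside ∷ p)  f g = trans (cong (f fzero + g fzero +_) (∑-+ p (f ∘ fsuc) (g ∘ fsuc)))
                                (interchange (f fzero) (g fzero) _ _)
  ∑-+ (outside ∷ p) f g = ∑-+ p (f ∘ fsuc) (g ∘ fsuc)

  ∑-* : ∀ {n} (p : Subset n) (k : ℕ) (f : Fin n → ℕ) → ∑⟨ p ⟩ (λ i → k * f i) ≡ k * ∑⟨ p ⟩ f
  ∑-* []            k f = sym (*-zeroʳ k)
  ∑-* (inside ∷ p)  k f = trans (cong (k * f fzero +_) (∑-* p k (f ∘ fsuc)))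
                                (sym (*-distribˡ-+ k (f fzero) _))
  ∑-* (outside ∷ p) k f = ∑-* p k (f ∘ fsuc)

  ∑-count : ∀ {n} (p : Subset n) → ∑⟨ p ⟩ (λ _ → 1) ≡ ∣ p ∣
  ∑-count []            = refl
  ∑-count (inside ∷ p)  = cong suc (∑-count p)
  ∑-count (outside ∷ p) = ∑-count p

  ∑-split : ∀ {n} (p q : Subset n) (f : Fin n → ℕ) → ∑⟨ p ⟩ f ≡ ∑⟨ p ∩ q ⟩ f + ∑⟨ p ∩ ∁ q ⟩ f
  ∑-split []            []            f = refl
  ∑-split (inside ∷ p)  (inside ∷ q)  f = trans (cong (f fzero +_) (∑-split p q (f ∘ fsuc)))
                                                (sym (+-assoc (f fzero) _ _))
  ∑-split (inside ∷ p)  (outside ∷ q) f = trans (cong (f fzero +_) (∑-split p q (f ∘ fsuc)))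
                                                (x∙yz≈y∙xz (f fzero) (∑⟨ p ∩ q ⟩ (f ∘ fsuc)) _)
  ∑-split (outside ∷ p) (inside ∷ q)  f = ∑-split p q (f ∘ fsuc)
  ∑-split (outside ∷ p) (outside ∷ q) f = ∑-split p q (f ∘ fsuc)

  ∑-∩⁅⁆ : ∀ {n} (p : Subset n) {x} (f : Fin n → ℕ) → x ∈ p → ∑⟨ p ∩ ⁅ x ⁆ ⟩ f ≡ f x
  ∑-∩⁅⁆ (inside ∷ p)  f here        = trans (cong (f fzero +_) (∑-∩∅ p (f ∘ fsuc))) (+-identityʳ _)
    where
    ∑-∩∅ : ∀ {m} (q : Subset m) (g : Fin m → ℕ) → ∑⟨ q ∩ Subset.⊥ ⟩ g ≡ 0
    ∑-∩∅ []            g = refl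
    ∑-∩∅ (inside ∷ q)  g = ∑-∩∅ q (g ∘ fsuc)
    ∑-∩∅ (outside ∷ q) g = ∑-∩∅ q (g ∘ fsuc)
  ∑-∩⁅⁆ (inside ∷ p)  f (there x∈p) = ∑-∩⁅⁆ p (f ∘ fsuc) x∈p
  ∑-∩⁅⁆ (outside ∷ p) f (there x∈p) = ∑-∩⁅⁆ p (f ∘ fsuc) x∈p

  ∑-remove : ∀ {n} (p : Subset n) {x} (f : Fin n → ℕ) → x ∈ p → ∑⟨ p ⟩ f ≡ f x + ∑⟨ p ∖ x ⟩ f
  ∑-remove p {x} f x∈p = trans (∑-split p ⁅ x ⁆ f) (cong (_+ ∑⟨ p ∖ x ⟩ f) (∑-∩⁅⁆ p f x∈p))

  ∑-⊤ : ∀ {n} (f : Fin n → ℕ) → ∑⟨ ⊤ ⟩ f ≡ sum (map f (allFin n))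
  ∑-⊤ {n} f = trans (∑-⊤-tabulate f) (cong sum (sym (map-tabulate (λ i → i) f)))
    where
    ∑-⊤-tabulate : ∀ {m} (g : Fin m → ℕ) → ∑⟨ ⊤ ⟩ g ≡ sum (tabulate g)
    ∑-⊤-tabulate {zero}  g = refl
    ∑-⊤-tabulate {suc m} g = cong (g fzero +_) (∑-⊤-tabulate (g ∘ fsuc))

  card-split : ∀ {n} (p q : Subset n) → ∣ p ∣ ≡ ∣ p ∩ q ∣ + ∣ p ∩ ∁ q ∣
  card-split p q = trans (sym (∑-count p))
    (trans (∑-split p q (λ _ → 1)) (cong₂ _+_ (∑-count (p ∩ q)) (∑-count (p ∩ ∁ q))))

  card-remove : ∀ {n} (p : Subset n) {x} → x ∈ p → ∣ p ∣ ≡ suc ∣ p ∖ x ∣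
  card-remove p {x} x∈p =
    trans (sym (∑-count p)) (trans (∑-remove p (λ _ → 1) x∈p) (cong suc (∑-count (p ∖ x))))

  card-∪ : ∀ {n} (p q : Subset n) → ∣ p ∪ q ∣ ≤ ∣ p ∣ + ∣ q ∣
  card-∪ []            []            = z≤n
  card-∪ (inside ∷ p)  (s ∷ q)       = s≤s (≤-trans (card-∪ p q) (+-monoʳ-≤ ∣ p ∣ (∣p∣≤∣x∷p∣ s q)))
  card-∪ (outside ∷ p) (inside ∷ q)  = ≤-trans (s≤s (card-∪ p q)) (≤-reflexive (sym (+-suc ∣ p ∣ ∣ q ∣)))
  card-∪ (outside ∷ p) (outside ∷ q) = card-∪ p q

  ∩-⊆ : ∀ {n} {p q : Subset n} → q ⊆ p → p ∩ q ≡ q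
  ∩-⊆ {p = p} {q} q⊆p = ⊆-antisym (p∩q⊆q p q) (λ x∈q → x∈p∩q⁺ (q⊆p x∈q , x∈q))

  count-zeros : ∀ {n} (p k : Subset n) (f : Fin n → ℕ) →
                (∀ {i} → i ∈ p → f i ≡ 0 → i ∈ k) → ∣ p ∣ ≤ ∣ k ∣ + ∑⟨ p ⟩ f
  count-zeros p k f zeros∈k = begin
    ∣ p ∣                                   ≡⟨ card-split p k ⟩
    ∣ p ∩ k ∣ + ∣ p ∩ ∁ k ∣                 ≤⟨ +-mono-≤ (∣p∩q∣≤∣q∣ p k) outside-k ⟩
    ∣ k ∣ + ∑⟨ p ∩ ∁ k ⟩ f                  ≤⟨ +-monoʳ-≤ ∣ k ∣ (m≤n+m _ (∑⟨ p ∩ k ⟩ f)) ⟩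
    ∣ k ∣ + (∑⟨ p ∩ k ⟩ f + ∑⟨ p ∩ ∁ k ⟩ f) ≡⟨ cong (∣ k ∣ +_) (∑-split p k f) ⟨
    ∣ k ∣ + ∑⟨ p ⟩ f                        ∎
    where
    open ≤-Reasoning
    positive : ∀ {i} → i ∈ p ∩ ∁ k → 1 ≤ f i
    positive m with x∈p∩q⁻ p (∁ k) m
    ... | i∈p , i∈∁k = n≢0⇒n>0 (λ fi≡0 → x∈∁p⇒x∉p i∈∁k (zeros∈k i∈p fi≡0))
    outside-k : ∣ p ∩ ∁ k ∣ ≤ ∑⟨ p ∩ ∁ k ⟩ f
    outside-k = subst (_≤ ∑⟨ p ∩ ∁ k ⟩ f) (∑-count (p ∩ ∁ k)) (∑-mono (p ∩ ∁ k) positive)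

  -- Summing an inequality over the blocks of a partition: blk x is the block
  -- of x ∈ D, and the blocks partition D.
  module Blocks {n : ℕ} (D : Subset n) (blk : Fin n → Subset n)
                (blk-refl : ∀ {x} → x ∈ D → x ∈ blk x)
                (blk-⊆    : ∀ {x} → x ∈ D → blk x ⊆ D)
                (blk-≡    : ∀ {x y} → x ∈ D → y ∈ blk x → blk y ≡ blk x) where

    ∑-blocks : (f g : Fin n → ℕ) → (∀ {x} → x ∈ D → ∑⟨ blk x ⟩ f ≤ ∑⟨ blk x ⟩ g) → ∑⟨ D ⟩ f ≤ ∑⟨ D ⟩ g
    ∑-blocks f g blockwise = unions D (<-wellFounded ∣ D ∣) (λ x∈D → x∈D) blk-⊆
      where
      -- induction on the size of a union R of blocks, removing one block at a time
      unions : ∀ R → Acc _<_ ∣ R ∣ → R ⊆ D → (∀ {x} → x ∈ R → blk x ⊆ R) → ∑⟨ R ⟩ f ≤ ∑⟨ R ⟩ g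
      unions R (acc smaller) R⊆D closed with nonempty? R
      ... | no empty = ∑-mono R (λ x∈R → ⊥-elim (empty (_ , x∈R)))
      ... | yes (u , u∈R) = begin
        ∑⟨ R ⟩ f                  ≡⟨ decompose f ⟩
        ∑⟨ B ⟩ f + ∑⟨ R′ ⟩ f      ≤⟨ +-mono-≤ (blockwise (R⊆D u∈R)) (unions R′ (smaller R′<R) R′⊆D R′-closed) ⟩
        ∑⟨ B ⟩ g + ∑⟨ R′ ⟩ g      ≡⟨ decompose g ⟨
        ∑⟨ R ⟩ g                  ∎
        where
        open ≤-Reasoning
        B  = blk u
        R′ = R ∩ ∁ B
        R∩B≡B : R ∩ B ≡ B
        R∩B≡B = ∩-⊆ (closed u∈R)
        decompose : ∀ h → ∑⟨ R ⟩ h ≡ ∑⟨ B ⟩ h + ∑⟨ R′ ⟩ h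
        decompose h = trans (∑-split R B h) (cong (λ P → ∑⟨ P ⟩ h + ∑⟨ R′ ⟩ h) R∩B≡B)
        R∩B-nonempty : ∣ R ∩ B ∣ ≡ suc ∣ (R ∩ B) ∖ u ∣
        R∩B-nonempty = card-remove (R ∩ B) (x∈p∩q⁺ (u∈R , blk-refl (R⊆D u∈R)))
        R′<R : ∣ R′ ∣ < ∣ R ∣
        R′<R = subst (∣ R′ ∣ <_) (sym (trans (card-split R B) (cong (_+ ∣ R′ ∣) R∩B-nonempty)))
                     (s≤s (m≤n+m ∣ R′ ∣ _))
        R′⊆D : R′ ⊆ D
        R′⊆D x∈R′ = R⊆D (proj₁ (x∈p∩q⁻ R (∁ B) x∈R′))
        R′-closed : ∀ {x} → x ∈ R′ → blk x ⊆ R′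
        R′-closed {x} x∈R′ {y} y∈bx with x∈p∩q⁻ R (∁ B) x∈R′
        ... | x∈R , x∈∁B = x∈p∩q⁺ (closed x∈R y∈bx , x∉p⇒x∈∁p y∉B)
          where
          y∉B : y ∉ B
          y∉B y∈B = x∈∁p⇒x∉p x∈∁B
            (subst (x ∈_) (trans (sym (blk-≡ (R⊆D x∈R) y∈bx)) (blk-≡ (R⊆D u∈R) y∈B)) (blk-refl (R⊆D x∈R)))

open Subsets

module _ {n : ℕ} {P : Pred (Fin n) 0ℓ} (P? : Decidable P) where

  select : Subset n
  select = tabulateᵛ (λ x → does (P? x))

  select⁺ : ∀ {x} → P x → x ∈ select
  select⁺ {x} px = lookup⇒[]= x select (trans (lookup∘tabulate _ x) (accepted (P? x)))
    where
    accepted : (d : Dec (P x)) → does d ≡ inside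
    accepted (yes _)  = refl
    accepted (no ¬px) = ⊥-elim (¬px px)

  select⁻ : ∀ {x} → x ∈ select → P x
  select⁻ {x} x∈s with P? x | trans (sym (lookup∘tabulate (λ y → does (P? y)) x)) ([]=⇒lookup x∈s)
  ... | yes px | _ = px

module Trees {n : ℕ} (T : Graph n) (tree : IsTree T) where
  open Walks T
  open Acyclic T (proj₂ tree)

  π : ∀ u v → Walk T u v
  π u v = proj₁ (toPath (proj₁ tree u v))

  π-path : ∀ u v → IsPath T (π u v)
  π-path u v = proj₁ (proj₂ (toPath (proj₁ tree u v)))

  path-within : ∀ {S u v} → ConnectedIn T S → u ∈ S → v ∈ S →
                (p : Walk T u v) → IsPath T p → ∀ {x} → x L.∈ verts T p → x ∈ S
  path-within cS u∈S v∈S p up x∈p with cS _ _ u∈S v∈S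
  ... | w , w⊆S = All.lookup w⊆S (path⊆walk p up w x∈p)

-- The connected components of T[S] - r, for a tree T.  The component of u
-- consists of the x whose path from u avoids r and stays in S.
module Components {n : ℕ} (T : Graph n) (tree : IsTree T) (S : Subset n) (r : Fin n) where
  open Graph T using (Adj)
  open Walks T
  open Piece
  open Acyclic T (proj₂ tree)
  open Trees T tree

  X : Subset n
  X = S ∖ r

  comp : Fin n → Subset n
  comp u = select (λ x → all? (_∈? X) (verts T (π u x)))

  comp-intro : ∀ {u x} (w : Walk T u x) → (∀ {y} → y L.∈ verts T w → y ∈ X) → x ∈ comp u
  comp-intro {u} {x} w w⊆X =
    select⁺ (λ x → all? (_∈? X) (verts T (π u x))) (All.tabulate (w⊆X ∘ path⊆walk (π u x) (π-path u x) w))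

  comp-path : ∀ {u x} → x ∈ comp u → ∀ {y} → y L.∈ verts T (π u x) → y ∈ X
  comp-path {u} x∈cu = All.lookup (select⁻ (λ x → all? (_∈? X) (verts T (π u x))) x∈cu)

  comp⊆X : ∀ {u x} → x ∈ comp u → x ∈ X
  comp⊆X {u} {x} x∈cu = comp-path x∈cu (last∈ (π u x))

  comp-refl : ∀ {u} → u ∈ X → u ∈ comp u
  comp-refl u∈X = comp-intro here λ { (here refl) → u∈X }

  comp-sym : ∀ {u x} → x ∈ comp u → u ∈ comp x
  comp-sym {u} {x} x∈cu = comp-intro (rev (π u x)) (comp-path x∈cu ∘ verts-rev (π u x))

  comp-trans : ∀ {u x y} → x ∈ comp u → y ∈ comp x → y ∈ comp u
  comp-trans {u} {x} {y} x∈cu y∈cx = comp-intro (π u x ++ʷ π x y) λ m →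
    [ comp-path x∈cu , comp-path y∈cx ]′ (∈-++ʷ⁻ (π u x) (π x y) m)

  comp-≡ : ∀ {u x} → x ∈ comp u → comp x ≡ comp u
  comp-≡ x∈cu = ⊆-antisym (comp-trans x∈cu) (comp-trans (comp-sym x∈cu))

  comp-along : ∀ {u x} → x ∈ comp u → ∀ {z} → z L.∈ verts T (π u x) → z ∈ comp u
  comp-along {u} {x} x∈cu z∈π = comp-intro (walk s) (comp-path x∈cu ∘ within s)
    where s = prefix (π u x) z∈π

  comp-connected : ∀ u → ConnectedIn T (comp u)
  comp-connected u x y x∈cu y∈cu = rev (π u x) ++ʷ π u y , All.tabulate λ m →
    [ comp-along x∈cu ∘ verts-rev (π u x) , comp-along y∈cu ]′ (∈-++ʷ⁻ (rev (π u x)) (π u y) m)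

  comp-closed : ∀ {u} x y → x ∈ comp u → y ∈ S → y ≢ r → Adj x y → y ∈ comp u
  comp-closed {u} x y x∈cu y∈S y≢r e = comp-intro (π u x ++ʷ step e here) λ m →
    [ comp-path x∈cu , (λ { (here refl) → comp⊆X x∈cu ; (there (here refl)) → ∈∖⁺ y∈S y≢r }) ]′
      (∈-++ʷ⁻ (π u x) (step e here) m)

  comp-isComponent : ∀ {u} → u ∈ X → IsComponent T S r (comp u)
  comp-isComponent {u} u∈X =
    proj₁ ∘ ∈∖⁻ ∘ comp⊆X , (λ r∈cu → proj₂ (∈∖⁻ (comp⊆X r∈cu)) refl) , (u , comp-refl u∈X) ,
    comp-connected u , comp-closed

module SeparatorStep {n : ℕ} {S : Subset n} {r : Fin n} {H H′ : Fin n → Subset n}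
                     (H-sep : H r ≡ ⁅ r ⁆) (H-rest : ∀ x → x ∈ S → x ≢ r → H x ≡ H′ x ∪ ⁅ r ⁆) where

  sep∈H : ∀ {x} → x ∈ S → r ∈ H x
  sep∈H {x} x∈S with x ≟ r
  ... | yes refl = subst (r ∈_) (sym H-sep) (x∈⁅x⁆ r)
  ... | no x≢r   = subst (r ∈_) (sym (H-rest x x∈S x≢r)) (x∈p∪q⁺ (inj₂ (x∈⁅x⁆ r)))

  H′⊆H : ∀ {x} → x ∈ S ∖ r → H′ x ⊆ H x
  H′⊆H {x} x∈X w∈H′x with ∈∖⁻ x∈X
  ... | x∈S , x≢r = subst (_ ∈_) (sym (H-rest x x∈S x≢r)) (x∈p∪q⁺ (inj₁ w∈H′x))

  cost-step : r ∈ S → ∑⟨ S ⟩ (∣_∣ ∘ H) ≤ ∣ S ∣ + ∑⟨ S ∖ r ⟩ (∣_∣ ∘ H′)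
  cost-step r∈S = begin
    ∑⟨ S ⟩ (∣_∣ ∘ H)                   ≡⟨ ∑-remove S (∣_∣ ∘ H) r∈S ⟩
    ∣ H r ∣ + ∑⟨ S ∖ r ⟩ (∣_∣ ∘ H)     ≤⟨ +-mono-≤ (≤-reflexive ∣Hr∣≡1) (∑-mono (S ∖ r) ∣Hx∣≤) ⟩
    1 + ∑⟨ S ∖ r ⟩ (λ x → 1 + ∣ H′ x ∣) ≡⟨ cong suc (∑-+ (S ∖ r) (λ _ → 1) (∣_∣ ∘ H′)) ⟩
    1 + (∑⟨ S ∖ r ⟩ (λ _ → 1) + rest)  ≡⟨ cong (λ k → 1 + (k + rest)) (∑-count (S ∖ r)) ⟩
    1 + ∣ S ∖ r ∣ + rest               ≡⟨ cong (_+ rest) (card-remove S r∈S) ⟨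
    ∣ S ∣ + rest                       ∎
    where
    open ≤-Reasoning
    rest = ∑⟨ S ∖ r ⟩ (∣_∣ ∘ H′)
    ∣Hr∣≡1 : ∣ H r ∣ ≡ 1
    ∣Hr∣≡1 = trans (cong ∣_∣ H-sep) (∣⁅x⁆∣≡1 r)
    ∣Hx∣≤ : ∀ {x} → x ∈ S ∖ r → ∣ H x ∣ ≤ 1 + ∣ H′ x ∣
    ∣Hx∣≤ {x} x∈X with ∈∖⁻ x∈X
    ... | x∈S , x≢r = begin
      ∣ H x ∣              ≡⟨ cong ∣_∣ (H-rest x x∈S x≢r) ⟩
      ∣ H′ x ∪ ⁅ r ⁆ ∣     ≤⟨ card-∪ (H′ x) ⁅ r ⁆ ⟩
      ∣ H′ x ∣ + ∣ ⁅ r ⁆ ∣ ≡⟨ +-comm ∣ H′ x ∣ _ ⟩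
      ∣ ⁅ r ⁆ ∣ + ∣ H′ x ∣ ≡⟨ cong (_+ ∣ H′ x ∣) (∣⁅x⁆∣≡1 r) ⟩
      1 + ∣ H′ x ∣         ∎

module Correctness {n : ℕ} (T : Graph n) (tree : IsTree T) where
  open Walks T
  open Trees T tree

  treeAlg-hubs : ∀ {S H} → TreeAlg T S H → ConnectedIn T S → ∀ {u v} → u ∈ S → v ∈ S →
                 ∃[ w ] (w ∈ H u × w ∈ H v × OnPath T w u v)
  treeAlg-hubs {S} {H} (run r (r∈S , _) H′ recursive H-sep H-rest) cS {u} {v} u∈S v∈S
    with _∈ᴸ?_ _≟_ r (verts T (π u v))
  ... | yes r∈π = r , sep∈H u∈S , sep∈H v∈S , π u v , π-path u v , r∈π
    where open SeparatorStep H-sep H-rest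
  ... | no r∉π =
    lift (treeAlg-hubs (recursive (comp u) (comp-isComponent u∈X)) (comp-connected u) (comp-refl u∈X) v∈cu)
    where
    open SeparatorStep H-sep H-rest
    open Components T tree S r
    -- the u–v path avoids r, so it runs inside one component of T[S] - r
    π⊆X : ∀ {y} → y L.∈ verts T (π u v) → y ∈ X
    π⊆X y∈π = ∈∖⁺ (path-within cS u∈S v∈S (π u v) (π-path u v) y∈π) λ { refl → r∉π y∈π }
    u∈X : u ∈ X
    u∈X = π⊆X (first∈ (π u v))
    v∈cu : v ∈ comp u
    v∈cu = comp-intro (π u v) π⊆X
    lift : ∃[ w ] (w ∈ H′ u × w ∈ H′ v × OnPath T w u v) → ∃[ w ] (w ∈ H u × w ∈ H v × OnPath T w u v)
    lift (w , w∈H′u , w∈H′v , w-on-path) = w , H′⊆H u∈X w∈H′u , H′⊆H (comp⊆X v∈cu) w∈H′v , w-on-path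

halving : ∀ s k o → s ≤ 1 + k + o → 2 * k ≤ s → s ≤ 2 + 2 * o
halving s k o s≤ 2k≤s = +-cancelˡ-≤ s s (2 + 2 * o) (begin
  s + s                           ≤⟨ +-mono-≤ s≤ s≤ ⟩
  (1 + k + o) + (1 + k + o)       ≡⟨ double k o ⟩
  2 * k + (2 + 2 * o)             ≤⟨ +-monoˡ-≤ (2 + 2 * o) 2k≤s ⟩
  s + (2 + 2 * o)                 ∎)
  where
  open ≤-Reasoning
  double : ∀ k o → (1 + k + o) + (1 + k + o) ≡ 2 * k + (2 + 2 * o)
  double = solve-∀

module Approximation {n : ℕ} (T : Graph n) (tree : IsTree T)
                     (H* : Fin n → Subset n) (hubs : IsHubLabeling T H*) where
  open Acyclic T (proj₂ tree)
  open Trees T tree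

  B : Subset n → ℕ
  B S = ∑⟨ S ⟩ (λ u → ∣ H* u ∩ S ∣)

  -- the only vertex on a path from u to u is u, so u is its own hub
  self-hub : ∀ u → u ∈ H* u
  self-hub u with hubs u u
  ... | w , w∈H*u , _ , p , up , w∈p with path⊆walk p up here w∈p
  ... | here refl = w∈H*u

  module AtSeparator (S : Subset n) (r : Fin n) (cS : ConnectedIn T S) (r∈S : r ∈ S)
               (balanced : ∀ C → IsComponent T S r C → 2 * ∣ C ∣ ≤ ∣ S ∣) where
    open Components T tree S r

    comp⊆S : ∀ {u} → comp u ⊆ S
    comp⊆S = proj₁ ∘ ∈∖⁻ ∘ comp⊆X

    inner outer : Fin n → ℕ
    inner u = ∣ H* u ∩ comp u ∣
    outer u = ∣ (H* u ∩ S) ∩ ∁ (comp u) ∣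

    B-split : B S ≡ ∣ H* r ∩ S ∣ + (∑⟨ X ⟩ inner + ∑⟨ X ⟩ outer)
    B-split = trans (∑-remove S (λ u → ∣ H* u ∩ S ∣) r∈S)
      (cong (∣ H* r ∩ S ∣ +_) (trans (∑-cong X inner+outer) (∑-+ X inner outer)))
      where
      inner+outer : ∀ {u} → u ∈ X → ∣ H* u ∩ S ∣ ≡ inner u + outer u
      inner+outer {u} _ = trans (card-split (H* u ∩ S) (comp u))
        (cong (λ P → ∣ P ∣ + outer u) (trans (∩-assoc (H* u) S (comp u)) (cong (H* u ∩_) (∩-⊆ comp⊆S))))

    contained : ∀ {u w} → outer u ≡ 0 → w ∈ H* u → w ∈ S → w ∈ comp u
    contained {u} {w} outer≡0 w∈H*u w∈S with w ∈? comp u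
    ... | yes w∈cu = w∈cu
    ... | no  w∉cu with trans (sym outer≡0) (card-remove _ (x∈p∩q⁺ (x∈p∩q⁺ (w∈H*u , w∈S) , x∉p⇒x∈∁p w∉cu)))
    ... | ()

    -- the vertices with outer u = 0 lie in a set of at most half the size of S:
    -- two of them share a hub in S, so they share their component
    concentrated : ∃[ K ] (2 * ∣ K ∣ ≤ ∣ S ∣ × (∀ {u} → u ∈ X → outer u ≡ 0 → u ∈ K))
    concentrated with any? (λ u → (u ∈? X) ×-dec (outer u ≟ℕ 0))
    ... | no none = Subset.⊥ , subst (λ k → 2 * k ≤ ∣ S ∣) (sym (∣⊥∣≡0 n)) z≤n ,
                    λ u∈X outer≡0 → ⊥-elim (none (_ , u∈X , outer≡0))
    ... | yes (b , b∈X , outer-b≡0) = comp b , balanced (comp b) (comp-isComponent b∈X) , in-comp-b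
      where
      in-comp-b : ∀ {u} → u ∈ X → outer u ≡ 0 → u ∈ comp b
      in-comp-b u∈X outer-u≡0 with hubs _ b
      ... | w , w∈H*u , w∈H*b , p , up , w∈p =
        comp-trans (contained outer-b≡0 w∈H*b w∈S) (comp-sym (contained outer-u≡0 w∈H*u w∈S))
        where w∈S = path-within cS (proj₁ (∈∖⁻ u∈X)) (proj₁ (∈∖⁻ b∈X)) p up w∈p

    separator-bound : ∣ S ∣ ≤ 2 * ∣ H* r ∩ S ∣ + 2 * ∑⟨ X ⟩ outer
    separator-bound with concentrated
    ... | K , 2K≤S , zeros∈K = ≤-trans (halving ∣ S ∣ ∣ K ∣ (∑⟨ X ⟩ outer) S≤ 2K≤S)
                                       (+-monoˡ-≤ (2 * ∑⟨ X ⟩ outer) (*-monoʳ-≤ 2 r∈H*r∩S))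
      where
      S≤ : ∣ S ∣ ≤ 1 + ∣ K ∣ + ∑⟨ X ⟩ outer
      S≤ = ≤-trans (≤-reflexive (card-remove S r∈S)) (s≤s (count-zeros X K outer zeros∈K))
      r∈H*r∩S : 1 ≤ ∣ H* r ∩ S ∣
      r∈H*r∩S rewrite card-remove (H* r ∩ S) (x∈p∩q⁺ (self-hub r , r∈S)) = s≤s z≤n

    lower-bound : ∣ S ∣ + 2 * ∑⟨ X ⟩ inner ≤ 2 * B S
    lower-bound = begin
      ∣ S ∣ + 2 * ∑⟨ X ⟩ inner                          ≤⟨ +-monoˡ-≤ _ separator-bound ⟩
      2 * ∣ H* r ∩ S ∣ + 2 * ∑⟨ X ⟩ outer + 2 * ∑⟨ X ⟩ inner ≡⟨ regroup ∣ H* r ∩ S ∣ (∑⟨ X ⟩ inner) (∑⟨ X ⟩ outer) ⟩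
      2 * (∣ H* r ∩ S ∣ + (∑⟨ X ⟩ inner + ∑⟨ X ⟩ outer)) ≡⟨ cong (2 *_) B-split ⟨
      2 * B S                                           ∎
      where
      open ≤-Reasoning
      regroup : ∀ h i o → 2 * h + 2 * o + 2 * i ≡ 2 * (h + (i + o))
      regroup = solve-∀

    recursive-bound : ∀ (H′ : Fin n → Subset n) →
                      (∀ C → IsComponent T S r C → ∑⟨ C ⟩ (∣_∣ ∘ H′) ≤ 2 * B C) →
                      ∑⟨ X ⟩ (∣_∣ ∘ H′) ≤ 2 * ∑⟨ X ⟩ inner
    recursive-bound H′ component-bound = subst (_ ≤_) (∑-* X 2 inner)
      (∑-blocks (∣_∣ ∘ H′) (λ u → 2 * inner u) λ {x} x∈X →
        subst (_ ≤_) (trans (cong (2 *_) (B-comp x)) (sym (∑-* (comp x) 2 inner)))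
              (component-bound (comp x) (comp-isComponent x∈X)))
      where
      open Blocks X comp comp-refl (λ _ → comp⊆X) (λ _ → comp-≡)
      B-comp : ∀ x → B (comp x) ≡ ∑⟨ comp x ⟩ inner
      B-comp x = ∑-cong (comp x) λ {v} v∈cx → cong (λ C → ∣ H* v ∩ C ∣) (sym (comp-≡ v∈cx))

  treeAlg-cost : ∀ {S H} → TreeAlg T S H → ConnectedIn T S → ∑⟨ S ⟩ (∣_∣ ∘ H) ≤ 2 * B S
  treeAlg-cost {S} {H} (run r (r∈S , balanced) H′ recursive H-sep H-rest) cS = begin
    ∑⟨ S ⟩ (∣_∣ ∘ H)                   ≤⟨ cost-step r∈S ⟩
    ∣ S ∣ + ∑⟨ S ∖ r ⟩ (∣_∣ ∘ H′)       ≤⟨ +-monoʳ-≤ ∣ S ∣ (recursive-bound H′ λ C C-comp →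
                                            treeAlg-cost (recursive C C-comp) (component-connected C-comp)) ⟩
    ∣ S ∣ + 2 * ∑⟨ S ∖ r ⟩ inner        ≤⟨ lower-bound ⟩
    2 * B S                            ∎
    where
    open ≤-Reasoning
    open SeparatorStep H-sep H-rest
    open AtSeparator S r cS r∈S balanced
    component-connected : ∀ {C} → IsComponent T S r C → ConnectedIn T C
    component-connected (_ , _ , _ , C-connected , _) = C-connected

mainTheorem2 : ∀ {n : ℕ} (T : Graph n) → IsTree T →
               (H : Fin n → Subset n) → TreeAlg T ⊤ H →
               IsHubLabeling T H ×
               (∀ (H* : Fin n → Subset n) → IsHubLabeling T H* →
                  cost T H ≤ 2 * cost T H*)
mainTheorem2 {n} T tree H alg = is-hub-labeling , two-approximation
  where
  all-connected : ConnectedIn T ⊤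
  all-connected u v _ _ = proj₁ tree u v , All.tabulate (λ _ → ∈⊤)

  is-hub-labeling : IsHubLabeling T H
  is-hub-labeling u v = Correctness.treeAlg-hubs T tree alg all-connected ∈⊤ ∈⊤

  two-approximation : ∀ H* → IsHubLabeling T H* → cost T H ≤ 2 * cost T H*
  two-approximation H* hubs = begin
    cost T H                     ≡⟨ ∑-⊤ (∣_∣ ∘ H) ⟨
    ∑⟨ ⊤ ⟩ (∣_∣ ∘ H)             ≤⟨ treeAlg-cost alg all-connected ⟩
    2 * B ⊤                      ≤⟨ *-monoʳ-≤ 2 (∑-mono ⊤ λ {u} _ → ∣p∩q∣≤∣p∣ (H* u) ⊤) ⟩
    2 * ∑⟨ ⊤ ⟩ (∣_∣ ∘ H*)        ≡⟨ cong (2 *_) (∑-⊤ (∣_∣ ∘ H*)) ⟩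
    2 * cost T H*                ∎
    where
    open ≤-Reasoning
    open Approximation T tree H* hubs
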